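{- Let $G$ be a finite bipartite graph with $\xi(G)=1$. Then $G$ has exactly one isolated vertex and $|V(G)|$ is odd.
   Context: $\Omega(G)$ is the set of maximum stable sets of $G$; $core(G)=\bigcap\{S:S\in\Omega(G)\}$ and $\xi(G)=|core(G)|$. -}

module Defs where

open import Data.Nat using (ℕ; _≤_)
open import Data.Fin using (Fin)
open import Data.Fin.Subset using (Subset; _∈_; ∣_∣)
open import Data.Bool using (Bool; true; false)
open import Data.Product using (_×_; Σ)
open import Relation.Binary.PropositionalEquality using (_≡_; _≢_)
open import Relation.Nullary using (¬_)

record Graph (n : ℕ) : Set where
  field
    adj       : Fin n → Fin n → Bool
    irrefl    : ∀ v → adj v v ≡ false
    sym       : ∀ u v → adj u v ≡ adj v u
open Graph public

Adj : ∀ {n} → Graph n → Fin n → Fin n → Set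
Adj G u v = adj G u v ≡ true

Bipartite : ∀ {n} → Graph n → Set
Bipartite {n} G = Σ (Fin n → Bool) λ c → ∀ u v → Adj G u v → c u ≢ c v

Stable : ∀ {n} → Graph n → Subset n → Set
Stable G S = ∀ u v → u ∈ S → v ∈ S → ¬ Adj G u v

MaxStable : ∀ {n} → Graph n → Subset n → Set
MaxStable G S = Stable G S × (∀ T → Stable G T → ∣ T ∣ ≤ ∣ S ∣)

IsCore : ∀ {n} → Graph n → Subset n → Set
IsCore G C = ∀ v → (v ∈ C → ∀ S → MaxStable G S → v ∈ S)
                 × ((∀ S → MaxStable G S → v ∈ S) → v ∈ C)

ξ≡ : ∀ {n} → Graph n → ℕ → Set
ξ≡ G k = Σ (Subset _) λ C → IsCore G C × ∣ C ∣ ≡ k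

Isolated : ∀ {n} → Graph n → Fin n → Set
Isolated G v = ∀ u → ¬ Adj G v u

ExactlyOneIsolated : ∀ {n} → Graph n → Set
ExactlyOneIsolated {n} G = Σ (Fin n) λ v → Isolated G v × (∀ w → Isolated G w → w ≡ v)

{-# OPTIONS --safe #-}
-- Let v be the unique core vertex and X its colour class.  For maximum stable
-- sets S and T, the set that is S ∩ T on X and S ∪ T off X is again maximum
-- stable: it is stable because ∁X is, and with its mirror image (S ∪ T on X,
-- S ∩ T off X) it has the size of S and T together.  Combining in this way the
-- maximum stable sets that each miss one non-core vertex of a colour class
-- gives maximum stable sets Q ⊆ {v} ∪ ∁X and P ⊆ X.  As ∁X is stable but misses
-- v, |∁X| < α = |Q| ≤ 1 + |∁X|; as X ⊇ P is stable, |X| = α, so n = 2|∁X| + 1.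
-- A neighbour u of v would lie in ∁X but not in Q, sharpening the bound to
-- α ≤ 1 + |∁X - u| = |∁X|, so v is isolated.  Every isolated vertex lies in
-- every maximum stable set, hence in the core, hence equals v.
module Submission where

open import Defs
open import Data.Nat using (ℕ; _%_)
open import Data.Product using (_×_)
open import Relation.Binary.PropositionalEquality using (_≡_)

open import Algebra.Properties.CommutativeSemigroup using (interchange)
open import Data.Bool.Base using (_∧_; _∨_; not)
open import Data.Bool.Properties using (¬-not) renaming (_≟_ to _≟ᵇ_)
open import Data.Empty using (⊥-elim)
open import Data.Fin.Base as Fin using (Fin)
open import Data.Fin.Properties using (all?)
open import Data.Fin.Subset
  using (Subset; Side; inside; outside; _∈_; _∉_; _⊆_; ∁; _∩_; _∪_; _-_; ⁅_⁆; ∣_∣)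
  renaming (⊥ to ∅)
open import Data.Fin.Subset.Properties
open import Data.List.Base using (List; []; _∷_; allFin)
open import Data.List.Membership.Propositional using () renaming (_∈_ to _∈ˡ_)
open import Data.List.Membership.Propositional.Properties using (∈-allFin)
open import Data.List.Relation.Unary.Any using (here; there)
open import Data.Nat.Base using (zero; suc; _+_; _≤_; _<_; z≤n)
open import Data.Nat.Properties
  using (≤-trans; ≤-<-trans; ≤-antisym; <⇒≱; ≮⇒≥; ≰⇒>; _<?_; _≤?_;
         +-suc; +-monoʳ-≤; +-cancelʳ-≤; m≤n+m; m+[n∸m]≡n; suc-injective;
         +-commutativeSemigroup; module ≤-Reasoning)
open import Data.Product using (Σ; ∃; _,_; proj₁; proj₂)
open import Data.Product as Product using ()
open import Data.Sum using (_⊎_; inj₁; inj₂; [_,_]′)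
open import Data.Sum as Sum using ()
open import Data.Vec.Base using ([]; _∷_; head; tail; tabulate)
open import Data.Vec.Properties using (lookup∘tabulate; []=⇒lookup; lookup⇒[]=)
open import Function.Base using (_∘_)
open import Relation.Binary.PropositionalEquality as ≡
  using (_≢_; refl; cong; cong₂; subst; module ≡-Reasoning)
open import Relation.Nullary using (yes; no; contradiction)
open import Relation.Nullary.Decidable using (_×-dec_; _→-dec_; ¬?; decidable-stable)
open import Relation.Unary using (Pred; Decidable)

χ : Side → ℕ
χ inside  = 1
χ outside = 0

∣∷∣ : ∀ {n} s (p : Subset n) → ∣ s ∷ p ∣ ≡ χ s + ∣ p ∣
∣∷∣ inside  p = refl
∣∷∣ outside p = refl

∣∷∣+∣∷∣≡∣∷∣+∣∷∣ : ∀ {n} (p q r s : Subset (suc n)) →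
                  χ (head p) + χ (head q) ≡ χ (head r) + χ (head s) →
                  ∣ tail p ∣ + ∣ tail q ∣ ≡ ∣ tail r ∣ + ∣ tail s ∣ →
                  ∣ p ∣ + ∣ q ∣ ≡ ∣ r ∣ + ∣ s ∣
∣∷∣+∣∷∣≡∣∷∣+∣∷∣ (a ∷ p) (b ∷ q) (c ∷ r) (d ∷ s) heads tails = begin
  ∣ a ∷ p ∣ + ∣ b ∷ q ∣           ≡⟨ cong₂ _+_ (∣∷∣ a p) (∣∷∣ b q) ⟩
  (χ a + ∣ p ∣) + (χ b + ∣ q ∣)   ≡⟨ interchange +-commutativeSemigroup (χ a) _ _ _ ⟩
  (χ a + χ b) + (∣ p ∣ + ∣ q ∣)   ≡⟨ cong₂ _+_ heads tails ⟩
  (χ c + χ d) + (∣ r ∣ + ∣ s ∣)   ≡⟨ interchange +-commutativeSemigroup (χ c) _ _ _ ⟩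
  (χ c + ∣ r ∣) + (χ d + ∣ s ∣)   ≡⟨ ≡.sym (cong₂ _+_ (∣∷∣ c r) (∣∷∣ d s)) ⟩
  ∣ c ∷ r ∣ + ∣ d ∷ s ∣           ∎
  where open ≡-Reasoning

∣p∩q∣+∣p∪q∣≡∣p∣+∣q∣ : ∀ {n} (p q : Subset n) → ∣ p ∩ q ∣ + ∣ p ∪ q ∣ ≡ ∣ p ∣ + ∣ q ∣
∣p∩q∣+∣p∪q∣≡∣p∣+∣q∣ []      []      = refl
∣p∩q∣+∣p∪q∣≡∣p∣+∣q∣ p′@(s ∷ p) q′@(t ∷ q) =
  ∣∷∣+∣∷∣≡∣∷∣+∣∷∣ (p′ ∩ q′) (p′ ∪ q′) p′ q′ (χ∧+χ∨ s t) (∣p∩q∣+∣p∪q∣≡∣p∣+∣q∣ p q)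
  where
  χ∧+χ∨ : ∀ s t → χ (s ∧ t) + χ (s ∨ t) ≡ χ s + χ t
  χ∧+χ∨ inside  inside  = refl
  χ∧+χ∨ inside  outside = refl
  χ∧+χ∨ outside inside  = refl
  χ∧+χ∨ outside outside = refl

∣p∪q∣≤∣p∣+∣q∣ : ∀ {n} (p q : Subset n) → ∣ p ∪ q ∣ ≤ ∣ p ∣ + ∣ q ∣
∣p∪q∣≤∣p∣+∣q∣ p q = subst (∣ p ∪ q ∣ ≤_) (∣p∩q∣+∣p∪q∣≡∣p∣+∣q∣ p q) (m≤n+m _ ∣ p ∩ q ∣)

p⊆⁅x⁆∪q⇒∣p∣≤1+∣q∣ : ∀ {n} {x : Fin n} {p q : Subset n} → p ⊆ ⁅ x ⁆ ∪ q → ∣ p ∣ ≤ suc ∣ q ∣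
p⊆⁅x⁆∪q⇒∣p∣≤1+∣q∣ {x = x} {p} {q} p⊆⁅x⁆∪q = begin
  ∣ p ∣               ≤⟨ p⊆q⇒∣p∣≤∣q∣ p⊆⁅x⁆∪q ⟩
  ∣ ⁅ x ⁆ ∪ q ∣       ≤⟨ ∣p∪q∣≤∣p∣+∣q∣ ⁅ x ⁆ q ⟩
  ∣ ⁅ x ⁆ ∣ + ∣ q ∣   ≡⟨ cong (_+ ∣ q ∣) (∣⁅x⁆∣≡1 x) ⟩
  suc ∣ q ∣           ∎
  where open ≤-Reasoning

∣p∣+∣∁p∣≡n : ∀ {n} (p : Subset n) → ∣ p ∣ + ∣ ∁ p ∣ ≡ n
∣p∣+∣∁p∣≡n p = ≡.trans (cong (∣ p ∣ +_) (∣∁p∣≡n∸∣p∣ p)) (m+[n∸m]≡n (∣p∣≤n p))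

∣p∣≡0⇒p≡∅ : ∀ {n} (p : Subset n) → ∣ p ∣ ≡ 0 → p ≡ ∅
∣p∣≡0⇒p≡∅ []            _ = refl
∣p∣≡0⇒p≡∅ (outside ∷ p) e = cong (outside ∷_) (∣p∣≡0⇒p≡∅ p e)

∣p∣≡1⇒p≡⁅x⁆ : ∀ {n} (p : Subset n) → ∣ p ∣ ≡ 1 → ∃ λ x → p ≡ ⁅ x ⁆
∣p∣≡1⇒p≡⁅x⁆ (inside  ∷ p) e = Fin.zero , cong (inside ∷_) (∣p∣≡0⇒p≡∅ p (suc-injective e))
∣p∣≡1⇒p≡⁅x⁆ (outside ∷ p) e = Product.map Fin.suc (cong (outside ∷_)) (∣p∣≡1⇒p≡⁅x⁆ p e)

∁∁p⊆p : ∀ {n} {p : Subset n} → ∁ (∁ p) ⊆ p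
∁∁p⊆p = x∉∁p⇒x∈p ∘ x∈∁p⇒x∉p

∈-tabulate⁻ : ∀ {n} {f : Fin n → Side} {x} → x ∈ tabulate f → f x ≡ inside
∈-tabulate⁻ {f = f} {x} x∈ = ≡.trans (≡.sym (lookup∘tabulate f x)) ([]=⇒lookup x∈)

∉-tabulate⁻ : ∀ {n} {f : Fin n → Side} {x} → x ∉ tabulate f → f x ≡ outside
∉-tabulate⁻ {f = f} {x} x∉ = ¬-not (x∉ ∘ lookup⇒[]= x (tabulate f) ∘ ≡.trans (lookup∘tabulate f x))

module _ {n ℓ} {P : Pred (Subset n) ℓ} (P? : Decidable P) where

  private
    Largest : Subset n → Set ℓ
    Largest q = P q × (∀ r → P r → ∣ r ∣ ≤ ∣ q ∣)

    largest-or-≥ : ∀ {p} → P p → ∀ k → Σ (Subset n) Largest ⊎ ∃ λ q → P q × k ≤ ∣ q ∣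
    largest-or-≥ {p} Pp zero = inj₂ (p , Pp , z≤n)
    largest-or-≥ Pp (suc k) with largest-or-≥ Pp k
    ... | inj₁ largest = inj₁ largest
    ... | inj₂ (q , Pq , k≤∣q∣)
      with anySubset? {P = λ r → P r × ∣ q ∣ < ∣ r ∣} (λ r → P? r ×-dec ∣ q ∣ <? ∣ r ∣)
    ...   | yes (r , Pr , ∣q∣<∣r∣) = inj₂ (r , Pr , ≤-<-trans k≤∣q∣ ∣q∣<∣r∣)
    ...   | no ∄larger = inj₁ (q , Pq , λ r Pr → ≮⇒≥ λ ∣q∣<∣r∣ → ∄larger (r , Pr , ∣q∣<∣r∣))

  ∃-largest : ∀ {p} → P p → Σ (Subset n) λ q → P q × (∀ r → P r → ∣ r ∣ ≤ ∣ q ∣)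
  ∃-largest Pp with largest-or-≥ Pp (suc n)
  ... | inj₁ largest          = largest
  ... | inj₂ (q , _ , n<∣q∣) = ⊥-elim (<⇒≱ n<∣q∣ (∣p∣≤n q))

suc[m+m]%2≡1 : ∀ m → suc (m + m) % 2 ≡ 1
suc[m+m]%2≡1 zero    = refl
suc[m+m]%2≡1 (suc m) rewrite +-suc m m = suc[m+m]%2≡1 m

exchange : ∀ {n} → Subset n → Subset n → Subset n → Subset n
exchange X S T = (S ∩ T) ∪ (∁ X ∩ (S ∪ T))

∣exchange∣+∣exchange-∁∣ : ∀ {n} (X S T : Subset n) →
                          ∣ exchange X S T ∣ + ∣ exchange (∁ X) S T ∣ ≡ ∣ S ∣ + ∣ T ∣
∣exchange∣+∣exchange-∁∣ []      []      []      = refl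
∣exchange∣+∣exchange-∁∣ X′@(x ∷ X) S′@(s ∷ S) T′@(t ∷ T) =
  ∣∷∣+∣∷∣≡∣∷∣+∣∷∣ (exchange X′ S′ T′) (exchange (∁ X′) S′ T′) S′ T′
    (χ-exchange x s t) (∣exchange∣+∣exchange-∁∣ X S T)
  where
  χ-exchange : ∀ x s t → χ ((s ∧ t) ∨ (not x ∧ (s ∨ t))) + χ ((s ∧ t) ∨ (not (not x) ∧ (s ∨ t)))
                         ≡ χ s + χ t
  χ-exchange inside  inside  inside  = refl
  χ-exchange inside  inside  outside = refl
  χ-exchange inside  outside inside  = refl
  χ-exchange inside  outside outside = refl
  χ-exchange outside inside  inside  = refl
  χ-exchange outside inside  outside = refl
  χ-exchange outside outside inside  = refl
  χ-exchange outside outside outside = refl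

module _ {n} {X S T : Subset n} {x : Fin n} where

  ∈-exchange⁻ : x ∈ exchange X S T → x ∈ S × x ∈ T ⊎ x ∈ ∁ X × x ∈ S ∪ T
  ∈-exchange⁻ = Sum.map (x∈p∩q⁻ S T) (x∈p∩q⁻ (∁ X) (S ∪ T)) ∘ x∈p∪q⁻ (S ∩ T) (∁ X ∩ (S ∪ T))

  ∈-exchange⇒∈⊎∈ : x ∈ exchange X S T → x ∈ S ⊎ x ∈ T
  ∈-exchange⇒∈⊎∈ = [ inj₁ ∘ proj₁ , x∈p∪q⁻ S T ∘ proj₂ ]′ ∘ ∈-exchange⁻

  ∈-exchange-inside⁻ : x ∈ X → x ∈ exchange X S T → x ∈ S × x ∈ T
  ∈-exchange-inside⁻ x∈X x∈E with ∈-exchange⁻ x∈E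
  ... | inj₁ x∈S∩T       = x∈S∩T
  ... | inj₂ (x∈∁X , _) = contradiction x∈X (x∈∁p⇒x∉p x∈∁X)

module _ {n} (G : Graph n) where

  adj-sym : ∀ {u v} → Adj G u v → Adj G v u
  adj-sym {u} {v} u~v = ≡.trans (Graph.sym G v u) u~v

  stable? : Decidable (Stable G)
  stable? S = all? λ u → all? λ v → u ∈? S →-dec v ∈? S →-dec ¬? (adj G u v ≟ᵇ inside)

  stable-⊆ : ∀ {S T} → Stable G T → S ⊆ T → Stable G S
  stable-⊆ sT S⊆T u v u∈S v∈S = sT u v (S⊆T u∈S) (S⊆T v∈S)

  isolated-∈⁅⁆ : ∀ {w x} → Isolated G w → x ∈ ⁅ w ⁆ → Isolated G x
  isolated-∈⁅⁆ {w} w-iso x∈⁅w⁆ = subst (Isolated G) (≡.sym (x∈⁅y⁆⇒x≡y w x∈⁅w⁆)) w-iso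

  stable-∪-isolated : ∀ {S w} → Stable G S → Isolated G w → Stable G (S ∪ ⁅ w ⁆)
  stable-∪-isolated {S} {w} sS w-iso u v u∈ v∈ with x∈p∪q⁻ S ⁅ w ⁆ u∈ | x∈p∪q⁻ S ⁅ w ⁆ v∈
  ... | inj₁ u∈S   | inj₁ v∈S   = sS u v u∈S v∈S
  ... | inj₂ u∈⁅w⁆ | _          = isolated-∈⁅⁆ w-iso u∈⁅w⁆ v
  ... | _          | inj₂ v∈⁅w⁆ = isolated-∈⁅⁆ w-iso v∈⁅w⁆ u ∘ adj-sym

  maxStable : Σ (Subset n) (MaxStable G)
  maxStable = ∃-largest stable? {∅} λ _ _ u∈∅ → contradiction u∈∅ ∉⊥

  isolated∈maxStable : ∀ {w S} → Isolated G w → MaxStable G S → w ∈ S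
  isolated∈maxStable {w} {S} w-iso (sS , maxS) = decidable-stable (w ∈? S) λ w∉S →
    <⇒≱ (p⊂q⇒∣p∣<∣q∣ (p⊆p∪q ⁅ w ⁆ , w , x∈p∪q⁺ (inj₂ (x∈⁅x⁆ w)) , w∉S))
        (maxS (S ∪ ⁅ w ⁆) (stable-∪-isolated sS w-iso))

  exchange-stable : ∀ {X S T} → Stable G (∁ X) → Stable G S → Stable G T →
                    Stable G (exchange X S T)
  exchange-stable s∁X sS sT u v u∈E v∈E with ∈-exchange⁻ u∈E | ∈-exchange⁻ v∈E
  ... | inj₁ (u∈S , u∈T) | _ = [ sS u v u∈S , sT u v u∈T ]′ (∈-exchange⇒∈⊎∈ v∈E)
  ... | _ | inj₁ (v∈S , v∈T) = [ (λ u∈S → sS u v u∈S v∈S) , (λ u∈T → sT u v u∈T v∈T) ]′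
                                 (∈-exchange⇒∈⊎∈ u∈E)
  ... | inj₂ (u∈∁X , _) | inj₂ (v∈∁X , _) = s∁X u v u∈∁X v∈∁X

  exchange-maxStable : ∀ {X S T} → Stable G X → Stable G (∁ X) →
                       MaxStable G S → MaxStable G T → MaxStable G (exchange X S T)
  exchange-maxStable {X} {S} {T} sX s∁X (sS , maxS) (sT , maxT) =
    exchange-stable s∁X sS sT , λ U sU → ≤-trans (maxS U sU) ∣S∣≤∣E∣
    where
    open ≤-Reasoning
    E E′ : Subset n
    E  = exchange X S T
    E′ = exchange (∁ X) S T
    ∣S∣≤∣E∣ : ∣ S ∣ ≤ ∣ E ∣
    ∣S∣≤∣E∣ = +-cancelʳ-≤ (∣ T ∣) (∣ S ∣) (∣ E ∣) (begin
      ∣ S ∣ + ∣ T ∣    ≡⟨ ≡.sym (∣exchange∣+∣exchange-∁∣ X S T) ⟩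
      ∣ E ∣ + ∣ E′ ∣   ≤⟨ +-monoʳ-≤ ∣ E ∣ (maxT E′ (exchange-stable (stable-⊆ sX ∁∁p⊆p) sS sT)) ⟩
      ∣ E ∣ + ∣ T ∣    ∎)

  module _ {c : Fin n → Side} (proper : ∀ u v → Adj G u v → c u ≢ c v) where

    colour-class-stable : Stable G (tabulate c)
    colour-class-stable u v u∈ v∈ u~v =
      proper u v u~v (≡.trans (∈-tabulate⁻ u∈) (≡.sym (∈-tabulate⁻ v∈)))

    ∁-colour-class-stable : Stable G (∁ (tabulate c))
    ∁-colour-class-stable u v u∈ v∈ u~v =
      proper u v u~v (≡.trans (∉-tabulate⁻ (x∈∁p⇒x∉p u∈)) (≡.sym (∉-tabulate⁻ (x∈∁p⇒x∉p v∈))))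

  side-containing : Bipartite G → ∀ v → ∃ λ X → v ∈ X × Stable G X × Stable G (∁ X)
  side-containing (c , proper) v with v ∈? tabulate c
  ... | yes v∈X = tabulate c , v∈X , colour-class-stable proper , ∁-colour-class-stable proper
  ... | no  v∉X = ∁ (tabulate c) , x∉p⇒x∈∁p v∉X , ∁-colour-class-stable proper ,
                  stable-⊆ (colour-class-stable proper) ∁∁p⊆p

  module _ {C : Subset n} (isCore : IsCore G C) where

    ∈-core⇒∈-maxStable : ∀ {x S} → x ∈ C → MaxStable G S → x ∈ S
    ∈-core⇒∈-maxStable {x} x∈C = proj₁ (isCore x) x∈C _

    ∈-core∧∉-stable⇒< : ∀ {x Q S} → x ∈ C → MaxStable G Q → Stable G S → x ∉ S → ∣ S ∣ < ∣ Q ∣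
    ∈-core∧∉-stable⇒< x∈C (_ , maxQ) sS x∉S = ≰⇒> λ ∣Q∣≤∣S∣ →
      x∉S (∈-core⇒∈-maxStable x∈C (sS , λ T sT → ≤-trans (maxQ T sT) ∣Q∣≤∣S∣))

    -- Comparing with one fixed maximum stable set S₀ makes maximality decidable.
    ∈-core-or-avoidable : ∀ x → x ∈ C ⊎ ∃ λ S → MaxStable G S × x ∉ S
    ∈-core-or-avoidable x
      with anySubset? {P = λ S → (Stable G S × ∣ S₀ ∣ ≤ ∣ S ∣) × x ∉ S}
                      (λ S → (stable? S ×-dec ∣ S₀ ∣ ≤? ∣ S ∣) ×-dec ¬? (x ∈? S))
      where S₀ = proj₁ maxStable
    ... | yes (S , (sS , ∣S₀∣≤∣S∣) , x∉S) =
      inj₂ (S , (sS , λ T sT → ≤-trans (proj₂ (proj₂ maxStable) T sT) ∣S₀∣≤∣S∣) , x∉S)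
    ... | no ∄avoiding = inj₁ (proj₂ (isCore x) λ S (sS , maxS) →
      decidable-stable (x ∈? S) λ x∉S →
        ∄avoiding (S , (sS , maxS _ (proj₁ (proj₂ maxStable))) , x∉S))

    module _ {X : Subset n} (sX : Stable G X) (s∁X : Stable G (∁ X)) where

      maxStable-avoiding : (xs : List (Fin n)) →
        ∃ λ Q → MaxStable G Q × ∀ {x} → x ∈ˡ xs → x ∈ X → x ∈ Q → x ∈ C
      maxStable-avoiding [] = proj₁ maxStable , proj₂ maxStable , λ ()
      maxStable-avoiding (x ∷ xs) with maxStable-avoiding xs | ∈-core-or-avoidable x
      ... | Q , maxQ , Q∩X⊆C | inj₁ x∈C = Q , maxQ , λ where
        (here refl)  _   _   → x∈C
        (there y∈xs) y∈X y∈Q → Q∩X⊆C y∈xs y∈X y∈Q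
      ... | Q , maxQ , Q∩X⊆C | inj₂ (S , maxS , x∉S) =
        exchange X Q S , exchange-maxStable sX s∁X maxQ maxS , λ where
          (here refl)  y∈X y∈E → contradiction (proj₂ (∈-exchange-inside⁻ y∈X y∈E)) x∉S
          (there y∈xs) y∈X y∈E → Q∩X⊆C y∈xs y∈X (proj₁ (∈-exchange-inside⁻ y∈X y∈E))

      maxStable-meeting-side-in-core : ∃ λ Q → MaxStable G Q × X ∩ Q ⊆ C
      maxStable-meeting-side-in-core with maxStable-avoiding (allFin n)
      ... | Q , maxQ , Q∩X⊆C = Q , maxQ , λ {x} x∈X∩Q →
        let x∈X , x∈Q = x∈p∩q⁻ X Q x∈X∩Q in Q∩X⊆C (∈-allFin x) x∈X x∈Q

module SingletonCore {n} {G : Graph n} {X : Subset n} (sX : Stable G X) (s∁X : Stable G (∁ X))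
                     {v : Fin n} (v∈X : v ∈ X) (isCore : IsCore G ⁅ v ⁆) where

  meeting-X : ∃ λ Q → MaxStable G Q × X ∩ Q ⊆ ⁅ v ⁆
  meeting-X = maxStable-meeting-side-in-core G isCore sX s∁X

  meeting-∁X : ∃ λ P → MaxStable G P × ∁ X ∩ P ⊆ ⁅ v ⁆
  meeting-∁X = maxStable-meeting-side-in-core G isCore s∁X (stable-⊆ G sX ∁∁p⊆p)

  Q P : Subset n
  Q = proj₁ meeting-X
  P = proj₁ meeting-∁X

  maxQ : MaxStable G Q
  maxQ = proj₁ (proj₂ meeting-X)

  maxP : MaxStable G P
  maxP = proj₁ (proj₂ meeting-∁X)

  Q⊆⁅v⁆∪∁X : Q ⊆ ⁅ v ⁆ ∪ ∁ X
  Q⊆⁅v⁆∪∁X {y} y∈Q with y ∈? X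
  ... | yes y∈X = x∈p∪q⁺ (inj₁ (proj₂ (proj₂ meeting-X) (x∈p∩q⁺ (y∈X , y∈Q))))
  ... | no  y∉X = x∈p∪q⁺ (inj₂ (x∉p⇒x∈∁p y∉X))

  P⊆X : P ⊆ X
  P⊆X {y} y∈P = decidable-stable (y ∈? X) λ y∉X →
    let y≡v = x∈⁅y⁆⇒x≡y v (proj₂ (proj₂ meeting-∁X) (x∈p∩q⁺ (x∉p⇒x∈∁p y∉X , y∈P)))
    in  y∉X (subst (_∈ X) (≡.sym y≡v) v∈X)

  ∣∁X∣<∣Q∣ : ∣ ∁ X ∣ < ∣ Q ∣
  ∣∁X∣<∣Q∣ = ∈-core∧∉-stable⇒< G isCore (x∈⁅x⁆ v) maxQ s∁X (x∈p⇒x∉∁p v∈X)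

  ∣Q∣≡1+∣∁X∣ : ∣ Q ∣ ≡ suc ∣ ∁ X ∣
  ∣Q∣≡1+∣∁X∣ = ≤-antisym (p⊆⁅x⁆∪q⇒∣p∣≤1+∣q∣ Q⊆⁅v⁆∪∁X) ∣∁X∣<∣Q∣

  ∣X∣≡∣Q∣ : ∣ X ∣ ≡ ∣ Q ∣
  ∣X∣≡∣Q∣ = ≤-antisym (proj₂ maxQ X sX) (≤-trans (proj₂ maxP Q (proj₁ maxQ)) (p⊆q⇒∣p∣≤∣q∣ P⊆X))

  v-isolated : Isolated G v
  v-isolated u v~u = <⇒≱ ∣∁X∣<∣Q∣ (begin
    ∣ Q ∣              ≤⟨ p⊆⁅x⁆∪q⇒∣p∣≤1+∣q∣ Q⊆⁅v⁆∪[∁X-u] ⟩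
    suc ∣ ∁ X - u ∣    ≤⟨ x∈p⇒∣p-x∣<∣p∣ u∈∁X ⟩
    ∣ ∁ X ∣            ∎)
    where
    open ≤-Reasoning
    u∈∁X : u ∈ ∁ X
    u∈∁X = x∉p⇒x∈∁p λ u∈X → sX v u v∈X u∈X v~u
    u∉Q : u ∉ Q
    u∉Q u∈Q = proj₁ maxQ v u (∈-core⇒∈-maxStable G isCore (x∈⁅x⁆ v) maxQ) u∈Q v~u
    Q⊆⁅v⁆∪[∁X-u] : Q ⊆ ⁅ v ⁆ ∪ (∁ X - u)
    Q⊆⁅v⁆∪[∁X-u] {y} y∈Q = x∈p∪q⁺ (Sum.map₂ (λ y∈∁X → x∈p∧x≢y⇒x∈p-y y∈∁X λ { refl → u∉Q y∈Q })
                                             (x∈p∪q⁻ ⁅ v ⁆ (∁ X) (Q⊆⁅v⁆∪∁X y∈Q)))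

  isolated≡v : ∀ w → Isolated G w → w ≡ v
  isolated≡v w w-iso = x∈⁅y⁆⇒x≡y v (proj₂ (isCore w) λ _ → isolated∈maxStable G w-iso)

  n-odd : n % 2 ≡ 1
  n-odd = subst (λ m → m % 2 ≡ 1) 1+2∣∁X∣≡n (suc[m+m]%2≡1 ∣ ∁ X ∣)
    where
    open ≡-Reasoning
    1+2∣∁X∣≡n : suc (∣ ∁ X ∣ + ∣ ∁ X ∣) ≡ n
    1+2∣∁X∣≡n = begin
      suc ∣ ∁ X ∣ + ∣ ∁ X ∣  ≡⟨ cong (_+ ∣ ∁ X ∣) (≡.sym (≡.trans ∣X∣≡∣Q∣ ∣Q∣≡1+∣∁X∣)) ⟩
      ∣ X ∣ + ∣ ∁ X ∣        ≡⟨ ∣p∣+∣∁p∣≡n X ⟩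
      n                      ∎

theorem8 : ∀ {n : ℕ} (G : Graph n) → Bipartite G → ξ≡ G 1 → ExactlyOneIsolated G × (n % 2 ≡ 1)
theorem8 G bipartite (C , isCore , ∣C∣≡1) with ∣p∣≡1⇒p≡⁅x⁆ C ∣C∣≡1
... | v , refl with side-containing G bipartite v
...   | X , v∈X , sX , s∁X = (v , v-isolated , isolated≡v) , n-odd
  where open SingletonCore {G = G} sX s∁X v∈X isCore
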